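{- Let $\mathcal{P}$ be a partition regular class and $(\vec{R},\sigma,X) \in \mathbb{P}_\mathcal{P}$. Let $\tau \subseteq X$ be a finite $\vec{R}$-transitive set and $Y \subseteq X$ an infinite set such that for every $R$ in $\vec{R}$, $\tau \to_R Y$ or $Y \to_R \tau$. Then $\vec{R} \in \mathcal{C}_{|\vec{R}|}(\sigma \cup \tau, Y)$.
   Context: Finite sets are identified with binary strings $\sigma$ via $F_\sigma = \{x<|\sigma|:\sigma(x)=1\}$; for strings/finite sets $\sigma,\tau$, $\sigma\cup\tau$ is the string of length $\max(|\sigma|,|\tau|)$ coding $F_\sigma \cup F_\tau$. A tournament on $\mathbb{N}$ is an irreflexive relation $R$ with exactly one of $R(a,b),R(b,a)$ for distinct $a,b$. A set is $R$-transitive if $R$ restricted to it is transitive; for a finite sequence $\vec R$ of tournaments, $\vec R$-transitive means $R$-transitive for each $R$ in $\vec R$. For sets $E,F$, $E \to_R F$ means $R(a,b)$ for all $a\in E$, $b \in F$. For a finite $R$-transitive set $F$, adjoin endpoints $-\infty,+\infty$ with $R(-\infty,x)$, $R(x,+\infty)$; for $a,b \in F \cup\{\pm\infty\}$ the interval $(a,b)$ is $\{x : R(a,x) \wedge R(x,b)\}$, minimal in $F$ if $(a,b)\cap F=\emptyset$. "$X$ is included in a minimal $\vec R$-interval of $\sigma$" means: for each $R$ in $\vec R$, $X$ is contained in a single minimal $R$-interval of $F_\sigma$. A class $\mathcal{P}\subseteq 2^\omega$ is partition regular if non-empty, upward closed, and whenever $X\in\mathcal{P}$ and $X \subseteq Y_1\cup\dots\cup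 Y_k$, some $Y_i \in \mathcal{P}$. $\mathbb{P}_\mathcal{P}$ is the set of triples $(\vec R,\sigma,X)$ with $\vec R$ a finite sequence of tournaments, $\sigma$ a binary string, $X\subseteq\mathbb{N}$, such that $X \cap\{0,\dots,|\sigma|\}=\emptyset$, $X\in\mathcal{P}$, $F_\sigma \cup\{y\}$ is $\vec R$-transitive for every $y \in X$, and $X$ is included in a minimal $\vec R$-interval of $\sigma$. For a string $\sigma$, a set $X$ and $m\in\mathbb{N}$, $\mathcal{C}_m(\sigma,X)$ is the class of all $m$-tuples $\vec S$ of tournaments such that $F_\sigma\cup\{y\}$ is $\vec S$-transitive for all $y \in X$ and $X$ is included in a minimal $\vec S$-interval of $\sigma$. -}

module Defs where

open import Data.Nat using (ℕ; zero; suc; _<_; _≤_)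
open import Data.Bool using (Bool; true; false; _∨_)
open import Data.List using (List; []; _∷_; length)
open import Data.Vec using (Vec; lookup)
open import Data.Fin using (Fin)
open import Data.Product using (Σ; ∃; _×_)
open import Data.Sum using (_⊎_)
open import Data.Unit using (⊤)
open import Data.Empty using (⊥)
open import Relation.Nullary using (¬_)
open import Relation.Binary.PropositionalEquality using (_≡_; _≢_)

SetN : Set₁
SetN = ℕ → Set

_⊆_ : SetN → SetN → Set
A ⊆ B = ∀ x → A x → B x

Rel : Set₁
Rel = ℕ → ℕ → Set

ForEach : ∀ {m} → (Rel → Set) → Vec Rel m → Set
ForEach {m} Q Rs = (i : Fin m) → Q (lookup Rs i)

-- Binary strings; bit out of range reads as false
String : Set
String = List Bool

bit : String → ℕ → Bool
bit []      _       = false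
bit (b ∷ _) zero    = b
bit (_ ∷ s) (suc n) = bit s n

F : String → SetN
F σ x = (x < length σ) × (bit σ x ≡ true)

_∪s_ : String → String → String
[]      ∪s t       = t
(a ∷ s) ∪s []      = a ∷ s
(a ∷ s) ∪s (b ∷ t) = (a ∨ b) ∷ (s ∪s t)

_∪1_ : SetN → ℕ → SetN
(A ∪1 y) x = A x ⊎ (x ≡ y)

Infinite : SetN → Set
Infinite Y = ∀ n → ∃ λ y → (n ≤ y) × Y y

IsTournament : Rel → Set
IsTournament R =
  (∀ a → ¬ R a a) ×
  (∀ a b → a ≢ b → (R a b ⊎ R b a) × ¬ (R a b × R b a))

Transitive : Rel → SetN → Set
Transitive R S = ∀ a b c → S a → S b → S c → R a b → R b c → R a c

TransitiveV : ∀ {m} → Vec Rel m → SetN → Set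
TransitiveV Rs S = ForEach (λ R → Transitive R S) Rs

_⟶[_]_ : SetN → Rel → SetN → Set
E ⟶[ R ] G = ∀ a b → E a → G b → R a b

data Ext : Set where
  -∞  : Ext
  fin : ℕ → Ext
  +∞  : Ext

RExt : Rel → Ext → Ext → Set
RExt R -∞      (fin _) = ⊤
RExt R -∞      +∞      = ⊤
RExt R (fin x) (fin y) = R x y
RExt R (fin _) +∞      = ⊤
RExt R _       _       = ⊥

InExt : SetN → Ext → Set
InExt A -∞      = ⊤
InExt A (fin x) = A x
InExt A +∞      = ⊤

Interval : Rel → Ext → Ext → SetN
Interval R a b x = RExt R a (fin x) × RExt R (fin x) b

InMinInterval : Rel → String → SetN → Set
InMinInterval R σ X =
  Σ Ext λ a → Σ Ext λ b →
    InExt (F σ) a × InExt (F σ) b ×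
    (∀ x → F σ x → ¬ Interval R a b x) ×
    (X ⊆ Interval R a b)

InMinIntervalV : ∀ {m} → Vec Rel m → String → SetN → Set
InMinIntervalV Rs σ X = ForEach (λ R → InMinInterval R σ X) Rs

PartitionRegular : (SetN → Set) → Set₁
PartitionRegular P =
  (Σ SetN P) ×
  (∀ X Y → X ⊆ Y → P X → P Y) ×
  (∀ X k (Ys : Vec SetN (suc k)) → P X →
     (X ⊆ (λ x → Σ (Fin (suc k)) λ i → lookup Ys i x)) →
     Σ (Fin (suc k)) λ i → P (lookup Ys i))

InForcing : (SetN → Set) → (m : ℕ) → Vec Rel m → String → SetN → Set
InForcing P m Rs σ X =
  ForEach IsTournament Rs ×
  (∀ x → X x → length σ < x) ×
  P X ×
  (∀ y → X y → TransitiveV Rs (F σ ∪1 y)) ×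
  InMinIntervalV Rs σ X

C : (m : ℕ) → String → SetN → Vec Rel m → Set
C m σ X Rs =
  ForEach IsTournament Rs ×
  (∀ y → X y → TransitiveV Rs (F σ ∪1 y)) ×
  InMinIntervalV Rs σ X

-- Every point of σ lies R-below all of X or R-above all of X: a point strictly
-- between two points of X would lie in the minimal interval of σ containing X.
-- Hence adding τ ⊆ X to σ keeps σ ∪ τ ∪ {y} transitive, since τ ∪ {y} is
-- transitive (y lies above, or below, all of τ). If τ →_R Y, the minimal
-- interval of σ ∪ τ containing Y runs from the R-maximum of τ (or the old lower
-- endpoint, if τ is empty) to the old upper endpoint.
module Submission where

open import Defs
open import Data.Nat using (ℕ; zero; suc; _<_; s≤s; z≤n)
open import Data.Nat.Properties using (_≟_; <⇒≢; <-trans; m<1+n⇒m<n∨m≡n; n<1+n)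
open import Data.Bool using (true; false; _∨_)
import Data.Bool as Bool
open import Data.Bool.Properties using (∨-identityʳ; ∨-zeroʳ)
open import Data.List using ([]; _∷_; length)
open import Data.Vec using (Vec; lookup)
open import Data.Product using (∃; _×_; _,_; proj₁; proj₂; swap)
open import Data.Sum using (_⊎_; inj₁; inj₂; [_,_]′)
import Data.Sum as Sum
open import Data.Unit using (tt)
open import Data.Empty using (⊥; ⊥-elim)
open import Function using (flip; _∘_; id)
open import Relation.Nullary using (¬_; yes; no)
open import Relation.Unary using (_∪_; Empty; Decidable)
open import Relation.Binary.PropositionalEquality using (_≡_; _≢_; refl; sym; trans; cong; subst₂)

module _ {R : Rel} (tournament : IsTournament R) where

  tournament-total : ∀ a b → a ≢ b → R a b ⊎ R b a
  tournament-total a b a≢b = proj₁ (proj₂ tournament a b a≢b)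

  tournament-asym : ∀ {a b} → R a b → R b a → ⊥
  tournament-asym {a} {b} Rab Rba with a ≟ b
  ... | yes refl = proj₁ tournament a Rab
  ... | no a≢b   = proj₂ (proj₂ tournament a b a≢b) (Rab , Rba)

IsTournament-flip : ∀ {R} → IsTournament R → IsTournament (flip R)
IsTournament-flip (irrefl , tot) =
  irrefl , λ a b a≢b → Sum.swap (proj₁ (tot a b a≢b)) , proj₂ (tot a b a≢b) ∘ swap

Transitive-flip : ∀ {R S} → Transitive R S → Transitive (flip R) S
Transitive-flip tr a b c a∈ b∈ c∈ Rba Rcb = tr c b a c∈ b∈ a∈ Rcb Rba

Transitive-⊆ : ∀ {R S T} → T ⊆ S → Transitive R S → Transitive R T
Transitive-⊆ T⊆S tr a b c a∈ b∈ c∈ = tr a b c (T⊆S a a∈) (T⊆S b b∈) (T⊆S c c∈)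

Transitive-∪1-top : ∀ {R E y} → IsTournament R → Transitive R E →
  (∀ x → E x → R x y) → Transitive R (E ∪1 y)
Transitive-∪1-top T tr below a b c (inj₁ a∈) (inj₁ b∈) (inj₁ c∈) Rab Rbc = tr a b c a∈ b∈ c∈ Rab Rbc
Transitive-∪1-top T tr below a b c (inj₁ a∈) _ (inj₂ refl) Rab Rbc = below a a∈
Transitive-∪1-top T tr below a b c (inj₂ refl) _ (inj₂ refl) Rab Rbc =
  ⊥-elim (tournament-asym T Rab Rbc)
Transitive-∪1-top T tr below a b c _ (inj₂ refl) (inj₁ c∈) Rab Rbc =
  ⊥-elim (tournament-asym T Rbc (below c c∈))
Transitive-∪1-top T tr below a b c (inj₂ refl) (inj₁ b∈) (inj₁ c∈) Rab Rbc =
  ⊥-elim (tournament-asym T Rab (below b b∈))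

Transitive-∪ : ∀ {R A B} → IsTournament R → Transitive R A → Transitive R B →
  (∀ b → B b → Transitive R (A ∪1 b)) → (∀ a b → A a → B b → a ≢ b) →
  (∀ z s z′ → B z → A s → B z′ → R z s → R s z′ → ⊥) → Transitive R (A ∪ B)
Transitive-∪ T trA trB trA∪1 disjoint between a b c (inj₁ a∈) (inj₁ b∈) (inj₁ c∈) =
  trA a b c a∈ b∈ c∈
Transitive-∪ T trA trB trA∪1 disjoint between a b c (inj₂ a∈) (inj₂ b∈) (inj₂ c∈) =
  trB a b c a∈ b∈ c∈
Transitive-∪ T trA trB trA∪1 disjoint between a b c (inj₂ a∈) (inj₁ b∈) (inj₁ c∈) =
  trA∪1 a a∈ a b c (inj₂ refl) (inj₁ b∈) (inj₁ c∈)
Transitive-∪ T trA trB trA∪1 disjoint between a b c (inj₁ a∈) (inj₂ b∈) (inj₁ c∈) =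
  trA∪1 b b∈ a b c (inj₁ a∈) (inj₂ refl) (inj₁ c∈)
Transitive-∪ T trA trB trA∪1 disjoint between a b c (inj₁ a∈) (inj₁ b∈) (inj₂ c∈) =
  trA∪1 c c∈ a b c (inj₁ a∈) (inj₁ b∈) (inj₂ refl)
Transitive-∪ T trA trB trA∪1 disjoint between a b c (inj₁ a∈) (inj₂ b∈) (inj₂ c∈) Rab Rbc
  with tournament-total T a c (disjoint a c a∈ c∈)
... | inj₁ Rac = Rac
... | inj₂ Rca = ⊥-elim (between c a b c∈ a∈ b∈ Rca Rab)
Transitive-∪ T trA trB trA∪1 disjoint between a b c (inj₂ a∈) (inj₁ b∈) (inj₂ c∈) Rab Rbc =
  ⊥-elim (between a b c a∈ b∈ c∈ Rab Rbc)
Transitive-∪ T trA trB trA∪1 disjoint between a b c (inj₂ a∈) (inj₂ b∈) (inj₁ c∈) Rab Rbc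
  with tournament-total T a c (disjoint c a c∈ a∈ ∘ sym)
... | inj₁ Rac = Rac
... | inj₂ Rca = ⊥-elim (between b c a b∈ c∈ a∈ Rbc Rca)

bit-∪s : ∀ σ τ x → bit (σ ∪s τ) x ≡ bit σ x ∨ bit τ x
bit-∪s []      τ       x       = refl
bit-∪s (a ∷ σ) []      x       = sym (∨-identityʳ (bit (a ∷ σ) x))
bit-∪s (a ∷ σ) (b ∷ τ) zero    = refl
bit-∪s (a ∷ σ) (b ∷ τ) (suc x) = bit-∪s σ τ x

bit≡true⇒F : ∀ σ x → bit σ x ≡ true → F σ x
bit≡true⇒F (b ∷ σ) zero    b≡true = s≤s z≤n , b≡true
bit≡true⇒F (b ∷ σ) (suc x) bit≡true with bit≡true⇒F σ x bit≡true
... | x<|σ| , _ = s≤s x<|σ| , bit≡true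

∨≡true⁻ : ∀ a b → a ∨ b ≡ true → a ≡ true ⊎ b ≡ true
∨≡true⁻ true  b _      = inj₁ refl
∨≡true⁻ false b b≡true = inj₂ b≡true

F-∪s⁻ : ∀ σ τ → F (σ ∪s τ) ⊆ (F σ ∪ F τ)
F-∪s⁻ σ τ x (_ , bit≡true) =
  Sum.map (bit≡true⇒F σ x) (bit≡true⇒F τ x)
    (∨≡true⁻ (bit σ x) (bit τ x) (trans (sym (bit-∪s σ τ x)) bit≡true))

F-∪s⁺ˡ : ∀ σ τ → F σ ⊆ F (σ ∪s τ)
F-∪s⁺ˡ σ τ x (_ , bit≡true) =
  bit≡true⇒F (σ ∪s τ) x (trans (bit-∪s σ τ x) (cong (_∨ bit τ x) bit≡true))

F-∪s⁺ʳ : ∀ σ τ → F τ ⊆ F (σ ∪s τ)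
F-∪s⁺ʳ σ τ x (_ , bit≡true) =
  bit≡true⇒F (σ ∪s τ) x
    (trans (bit-∪s σ τ x) (trans (cong (bit σ x ∨_) bit≡true) (∨-zeroʳ (bit σ x))))

F-∪s-avoids : ∀ σ τ {I : SetN} → (∀ x → F σ x → ¬ I x) → (∀ x → F τ x → ¬ I x) →
  ∀ x → F (σ ∪s τ) x → ¬ I x
F-∪s-avoids σ τ σ∉I τ∉I x x∈ = [ σ∉I x , τ∉I x ]′ (F-∪s⁻ σ τ x x∈)

Below : ℕ → SetN → SetN
Below n S x = x < n × S x

Below-suc⁺ : ∀ {n} S → Below n S ⊆ Below (suc n) S
Below-suc⁺ S x (x<n , x∈S) = <-trans x<n (n<1+n _) , x∈S

Below-suc⁻ : ∀ {n} S → Below (suc n) S ⊆ (Below n S ∪1 n)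
Below-suc⁻ S x (x<1+n , x∈S) = Sum.map (_, x∈S) id (m<1+n⇒m<n∨m≡n x<1+n)

IsMax : Rel → SetN → ℕ → Set
IsMax R S t = S t × (∀ x → S x → x ≡ t ⊎ R x t)

max-Below : ∀ {R S} → IsTournament R → Decidable S → ∀ n →
  Transitive R (Below n S) → Empty (Below n S) ⊎ ∃ (IsMax R (Below n S))
max-Below T S? zero tr = inj₁ λ _ ()
max-Below {R} {S} T S? (suc n) tr
  with S? n | max-Below T S? n (Transitive-⊆ (Below-suc⁺ S) tr)
... | no n∉S | inj₁ empty =
  inj₁ λ x x∈ → [ empty x , (λ { refl → n∉S (proj₂ x∈) }) ]′ (Below-suc⁻ S x x∈)
... | no n∉S | inj₂ (t , t∈ , max) =
  inj₂ (t , Below-suc⁺ S t t∈ ,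
        λ x x∈ → [ max x , (λ { refl → ⊥-elim (n∉S (proj₂ x∈)) }) ]′ (Below-suc⁻ S x x∈))
... | yes n∈S | inj₁ empty =
  inj₂ (n , (n<1+n n , n∈S) , λ x x∈ → [ ⊥-elim ∘ empty x , inj₁ ]′ (Below-suc⁻ S x x∈))
... | yes n∈S | inj₂ (t , t∈ , max) with tournament-total T t n (<⇒≢ (proj₁ t∈))
...   | inj₂ Rnt =
  inj₂ (t , Below-suc⁺ S t t∈ , λ x x∈ → [ max x , (λ { refl → inj₂ Rnt }) ]′ (Below-suc⁻ S x x∈))
...   | inj₁ Rtn =
  inj₂ (n , n∈ , λ x x∈ → [ inj₂ ∘ below-n x x∈ , inj₁ ]′ (Below-suc⁻ S x x∈))
  where
  n∈ : Below (suc n) S n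
  n∈ = n<1+n n , n∈S
  below-n : ∀ x → Below (suc n) S x → Below n S x → R x n
  below-n x x∈ x∈′ =
    [ (λ { refl → Rtn }) , (λ Rxt → tr x t n x∈ (Below-suc⁺ S t t∈) n∈ Rxt Rtn) ]′ (max x x∈′)

max-F : ∀ {R} τ → IsTournament R → Transitive R (F τ) → Empty (F τ) ⊎ ∃ (IsMax R (F τ))
max-F τ T = max-Below T (λ x → bit τ x Bool.≟ true) (length τ)

InExt-⊆ : ∀ {A B} a → A ⊆ B → InExt A a → InExt B a
InExt-⊆ -∞      A⊆B _  = tt
InExt-⊆ (fin x) A⊆B x∈ = A⊆B x x∈
InExt-⊆ +∞      A⊆B _  = tt

RExt-transʳ : ∀ {R S} a {z s} → Transitive R S → InExt S a → S z → S s →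
  RExt R a (fin z) → R z s → RExt R a (fin s)
RExt-transʳ -∞      tr _  _  _  _   _   = tt
RExt-transʳ (fin a) tr a∈ z∈ s∈ Raz Rzs = tr _ _ _ a∈ z∈ s∈ Raz Rzs

RExt-transˡ : ∀ {R S} b {s z} → Transitive R S → InExt S b → S s → S z →
  R s z → RExt R (fin z) b → RExt R (fin s) b
RExt-transˡ (fin b) tr b∈ s∈ z∈ Rsz Rzb = tr _ _ _ s∈ z∈ b∈ Rsz Rzb
RExt-transˡ +∞      tr _  _  _  _   _   = tt

InMinInterval⇒¬between : ∀ {R σ X} → (∀ z → X z → Transitive R (F σ ∪1 z)) →
  InMinInterval R σ X → ∀ z s z′ → X z → F σ s → X z′ → R z s → R s z′ → ⊥
InMinInterval⇒¬between tr (a , b , a∈ , b∈ , minimal , X⊆I) z s z′ z∈ s∈ z′∈ Rzs Rsz′ =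
  minimal s s∈
    ( RExt-transʳ a (tr z z∈) (InExt-⊆ a (λ _ → inj₁) a∈) (inj₂ refl) (inj₁ s∈)
        (proj₁ (X⊆I z z∈)) Rzs
    , RExt-transˡ b (tr z′ z′∈) (InExt-⊆ b (λ _ → inj₁) b∈) (inj₁ s∈) (inj₂ refl)
        Rsz′ (proj₂ (X⊆I z′ z′∈)))

reflect : Ext → Ext
reflect -∞      = +∞
reflect (fin x) = fin x
reflect +∞      = -∞

reflect-involutive : ∀ a → reflect (reflect a) ≡ a
reflect-involutive -∞      = refl
reflect-involutive (fin x) = refl
reflect-involutive +∞      = refl

InExt-reflect : ∀ {A} a → InExt A a → InExt A (reflect a)
InExt-reflect -∞      _  = tt
InExt-reflect (fin x) x∈ = x∈
InExt-reflect +∞      _  = tt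

RExt-flip : ∀ {R} a b → RExt R a b → RExt (flip R) (reflect b) (reflect a)
RExt-flip -∞      (fin y) _   = tt
RExt-flip -∞      +∞      _   = tt
RExt-flip (fin x) (fin y) Rxy = Rxy
RExt-flip (fin x) +∞      _   = tt

Interval-flip : ∀ {R} a b x → Interval R a b x → Interval (flip R) (reflect b) (reflect a) x
Interval-flip a b x (Rax , Rxb) = RExt-flip (fin x) b Rxb , RExt-flip a (fin x) Rax

Interval-unflip : ∀ {R} a b x → Interval (flip R) (reflect b) (reflect a) x → Interval R a b x
Interval-unflip {R} a b x I =
  subst₂ (λ a b → Interval R a b x) (reflect-involutive a) (reflect-involutive b)
    (Interval-flip (reflect b) (reflect a) x I)

InMinInterval-flip : ∀ {R σ X} → InMinInterval R σ X → InMinInterval (flip R) σ X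
InMinInterval-flip (a , b , a∈ , b∈ , minimal , X⊆I) =
  reflect b , reflect a , InExt-reflect b b∈ , InExt-reflect a a∈ ,
  (λ x x∈ → minimal x x∈ ∘ Interval-unflip a b x) ,
  (λ x x∈ → Interval-flip a b x (X⊆I x x∈))

Compatible : Rel → String → SetN → Set
Compatible R σ Y = (∀ y → Y y → Transitive R (F σ ∪1 y)) × InMinInterval R σ Y

Compatible-flip : ∀ {R σ Y} → Compatible R σ Y → Compatible (flip R) σ Y
Compatible-flip {σ = σ} (tr , I) =
  (λ y y∈ → Transitive-flip (tr y y∈)) , InMinInterval-flip {σ = σ} I

module Extension
  {R : Rel} (T : IsTournament R) (σ : String) {X : SetN}
  (X-above-σ : ∀ x → X x → length σ < x)
  (trans-σ∪1 : ∀ x → X x → Transitive R (F σ ∪1 x))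
  (minimal : InMinInterval R σ X)
  (τ : String) (τ⊆X : F τ ⊆ X) (trans-τ : Transitive R (F τ))
  {Y : SetN} (Y⊆X : Y ⊆ X) (τ⟶Y : F τ ⟶[ R ] Y) where

  transitive : ∀ y → Y y → Transitive R (F (σ ∪s τ) ∪1 y)
  transitive y y∈Y =
    Transitive-⊆ split
      (Transitive-∪ T
        (Transitive-⊆ (λ _ → inj₁) (trans-σ∪1 y (Y⊆X y y∈Y)))
        (Transitive-∪1-top T trans-τ (λ x x∈ → τ⟶Y x y x∈ y∈Y))
        (λ z z∈ → trans-σ∪1 z (τ∪y⊆X z z∈))
        disjoint
        (λ z s z′ z∈ s∈ z′∈ →
          InMinInterval⇒¬between {σ = σ} trans-σ∪1 minimal z s z′ (τ∪y⊆X z z∈) s∈ (τ∪y⊆X z′ z′∈)))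
    where
    τ∪y⊆X : (F τ ∪1 y) ⊆ X
    τ∪y⊆X x (inj₁ x∈τ) = τ⊆X x x∈τ
    τ∪y⊆X x (inj₂ refl) = Y⊆X y y∈Y
    disjoint : ∀ s z → F σ s → (F τ ∪1 y) z → s ≢ z
    disjoint s z s∈ z∈ = <⇒≢ (<-trans (proj₁ s∈) (X-above-σ z (τ∪y⊆X z z∈)))
    split : (F (σ ∪s τ) ∪1 y) ⊆ (F σ ∪ (F τ ∪1 y))
    split x (inj₁ x∈)  = Sum.map₂ inj₁ (F-∪s⁻ σ τ x x∈)
    split x (inj₂ x≡y) = inj₂ (inj₂ x≡y)

  interval : InMinInterval R (σ ∪s τ) Y
  interval = narrow minimal (max-F τ T trans-τ)
    where
    narrow : InMinInterval R σ X → Empty (F τ) ⊎ ∃ (IsMax R (F τ)) → InMinInterval R (σ ∪s τ) Y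
    narrow (a , b , a∈ , b∈ , σ∉I , X⊆I) (inj₁ τ-empty) =
      a , b , InExt-⊆ a (F-∪s⁺ˡ σ τ) a∈ , InExt-⊆ b (F-∪s⁺ˡ σ τ) b∈ ,
      F-∪s-avoids σ τ σ∉I (λ x x∈ _ → τ-empty x x∈) , λ y y∈ → X⊆I y (Y⊆X y y∈)
    narrow (a , b , a∈ , b∈ , σ∉I , X⊆I) (inj₂ (t , t∈ , max)) =
      fin t , b , F-∪s⁺ʳ σ τ t t∈ , InExt-⊆ b (F-∪s⁺ˡ σ τ) b∈ ,
      F-∪s-avoids σ τ σ∉J τ∉J , λ y y∈ → τ⟶Y t y t∈ y∈ , proj₂ (X⊆I y (Y⊆X y y∈))
      where
      t∈X : X t
      t∈X = τ⊆X t t∈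
      σ∉J : ∀ x → F σ x → ¬ Interval R (fin t) b x
      σ∉J x x∈ (Rtx , Rxb) =
        σ∉I x x∈ (RExt-transʳ a (trans-σ∪1 t t∈X) (InExt-⊆ a (λ _ → inj₁) a∈) (inj₂ refl) (inj₁ x∈)
                    (proj₁ (X⊆I t t∈X)) Rtx , Rxb)
      τ∉J : ∀ x → F τ x → ¬ Interval R (fin t) b x
      τ∉J x x∈ (Rtx , _) = [ (λ { refl → proj₁ T x Rtx }) , tournament-asym T Rtx ]′ (max x x∈)

  compatible : Compatible R (σ ∪s τ) Y
  compatible = transitive , interval

-- Reversing all edges swaps the two alternatives of the last hypothesis and
-- preserves the others, so the case Y →_R τ reduces to τ →_R Y.
extension : ∀ {R X Y} σ τ → IsTournament R → (∀ x → X x → length σ < x) →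
  (∀ x → X x → Transitive R (F σ ∪1 x)) → InMinInterval R σ X →
  F τ ⊆ X → Transitive R (F τ) → Y ⊆ X → (F τ ⟶[ R ] Y) ⊎ (Y ⟶[ R ] F τ) →
  Compatible R (σ ∪s τ) Y
extension σ τ T X-above-σ trans-σ∪1 minimal τ⊆X trans-τ Y⊆X (inj₁ τ⟶Y) =
  Extension.compatible T σ X-above-σ trans-σ∪1 minimal τ τ⊆X trans-τ Y⊆X τ⟶Y
extension σ τ T X-above-σ trans-σ∪1 minimal τ⊆X trans-τ Y⊆X (inj₂ Y⟶τ) =
  Compatible-flip {σ = σ ∪s τ}
    (Extension.compatible (IsTournament-flip T) σ X-above-σ
      (λ x x∈ → Transitive-flip (trans-σ∪1 x x∈)) (InMinInterval-flip {σ = σ} minimal)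
      τ τ⊆X (Transitive-flip trans-τ) Y⊆X (λ a b a∈ b∈ → Y⟶τ b a b∈ a∈))

lemma4p6 : (P : SetN → Set) → PartitionRegular P →
    (m : ℕ) (Rs : Vec Rel m) (σ : String) (X : SetN) →
    InForcing P m Rs σ X →
    (τ : String) → F τ ⊆ X → TransitiveV Rs (F τ) →
    (Y : SetN) → Y ⊆ X → Infinite Y →
    ForEach (λ R → (F τ ⟶[ R ] Y) ⊎ (Y ⟶[ R ] F τ)) Rs →
    C m (σ ∪s τ) Y Rs
lemma4p6 P _ m Rs σ X (tournaments , X-above-σ , _ , trans-σ∪1 , minimal)
         τ τ⊆X trans-τ Y Y⊆X _ sides =
  tournaments , (λ y y∈ i → proj₁ (compatible i) y y∈) , proj₂ ∘ compatible
  where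
  compatible : ∀ i → Compatible (lookup Rs i) (σ ∪s τ) Y
  compatible i =
    extension σ τ (tournaments i) X-above-σ (λ x x∈ → trans-σ∪1 x x∈ i) (minimal i)
      τ⊆X (trans-τ i) Y⊆X (sides i)
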